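{- Let $G$ be a homomorphically full oriented graph. Then the core of $G$ is an oriented clique.
   Context: All graphs are finite, loopless, without multiple edges. An oriented graph is a simple graph in which each edge is assigned a direction. A homomorphism of oriented graphs $G\to H$ is a map $V(G)\to V(H)$ sending arcs to arcs; it is complete if surjective on vertices and the induced map on arcs is surjective. A homomorphic image of an oriented graph $G$ is an oriented graph $H$ for which there is a complete homomorphism $G\to H$. An oriented graph $G$ is homomorphically full if every homomorphic image of $G$ is isomorphic to a subgraph of $G$. An oriented clique is an oriented graph in which any two non-adjacent vertices are the two ends of a directed path of length $2$. The core of $G$ is a subgraph $H$ of $G$ with the minimum number of vertices such that there is a homomorphism $G\to H$ (it is unique up to isomorphism). -}

module Defs where

open import Data.Nat using (ℕ; _≤_)
open import Data.Fin using (Fin)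
open import Data.Bool using (Bool; true; false)
open import Data.Product using (Σ; ∃; _×_)
open import Data.Sum using (_⊎_)
open import Relation.Binary.PropositionalEquality using (_≡_)
open import Relation.Nullary using (¬_)
open import Function.Definitions using (Injective)

record OGraph : Set where
  field
    size  : ℕ
    arc   : Fin size → Fin size → Bool
    loopless : ∀ u → arc u u ≡ false
    asym  : ∀ u v → arc u v ≡ true → arc v u ≡ false
open OGraph public

V : OGraph → Set
V G = Fin (size G)

Arc : (G : OGraph) → V G → V G → Set
Arc G u v = arc G u v ≡ true

IsHom : (G H : OGraph) → (V G → V H) → Set
IsHom G H f = ∀ u v → Arc G u v → Arc H (f u) (f v)

Hom : OGraph → OGraph → Set
Hom G H = Σ (V G → V H) (IsHom G H)

IsComplete : (G H : OGraph) → (V G → V H) → Set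
IsComplete G H f =
  IsHom G H f
  × (∀ x → ∃ λ u → f u ≡ x)
  × (∀ x y → Arc H x y → ∃ λ u → ∃ λ v → Arc G u v × f u ≡ x × f v ≡ y)

HomImage : OGraph → OGraph → Set
HomImage G H = Σ (V G → V H) (IsComplete G H)

-- H is isomorphic to a subgraph of G: an injective homomorphism H → G
-- (its image, with the image arcs, is a subgraph of G isomorphic to H).
SubgraphOf : OGraph → OGraph → Set
SubgraphOf H G = Σ (V H → V G) λ f → IsHom H G f × Injective _≡_ _≡_ f

HomFull : OGraph → Set
HomFull G = ∀ (H : OGraph) → HomImage G H → SubgraphOf H G

IsCore : OGraph → OGraph → Set
IsCore G H =
  SubgraphOf H G × Hom G H
  × (∀ (K : OGraph) → SubgraphOf K G → Hom G K → size H ≤ size K)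

OrientedClique : OGraph → Set
OrientedClique G =
  ∀ (u v : V G) → ¬ (u ≡ v) → ¬ (Arc G u v) → ¬ (Arc G v u) →
    ∃ λ w → (Arc G u w × Arc G w v) ⊎ (Arc G v w × Arc G w u)

module Submission where

-- If two distinct vertices a, b of the core H are non-adjacent and not joined
-- by a directed 2-path, then identifying b with a in H yields again an
-- oriented graph. Composing the retraction G → H with this identification,
-- the image of G is a homomorphic image of G, hence (G being homomorphically
-- full) a subgraph of G onto which G maps, with fewer vertices than H. This
-- contradicts the minimality of the core.

open import Defs
open import Data.Nat using (ℕ; zero; suc; _<_; s≤s)
open import Data.Nat.Properties using (≤⇒≯)
open import Data.Fin using (Fin; zero; suc; _≟_)
open import Data.Fin.Properties using (any?; injective⇒≤; punchOut-injective)
open import Data.Bool using (true; false)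
import Data.Bool as Bool
open import Data.Product using (∃; _×_; _,_)
open import Data.Sum using (_⊎_; inj₁; inj₂)
open import Data.Empty using (⊥; ⊥-elim)
open import Function using (_∘_)
open import Function.Definitions using (Injective)
open import Relation.Binary.PropositionalEquality
open import Relation.Nullary using (¬_; Dec; yes; no; does)
open import Relation.Nullary.Decidable using (_×-dec_; _⊎-dec_)

Arc? : (G : OGraph) → ∀ u v → Dec (Arc G u v)
Arc? G u v = arc G u v Bool.≟ true

record ImageFactorisation {n m : ℕ} (f : Fin n → Fin m) : Set where
  field
    card            : ℕ
    onto            : Fin n → Fin card
    into            : Fin card → Fin m
    onto-surjective : ∀ y → ∃ λ x → onto x ≡ y
    into-injective  : Injective _≡_ _≡_ into
    factorises      : ∀ x → into (onto x) ≡ f x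

imageFactorisation : ∀ {n m} (f : Fin n → Fin m) → ImageFactorisation f
imageFactorisation {zero} f = record
  { card = 0 ; onto = λ () ; into = λ () ; onto-surjective = λ ()
  ; into-injective = λ { {()} } ; factorises = λ () }
imageFactorisation {suc n} f with imageFactorisation (f ∘ suc)
... | record { card = k ; onto = e ; into = g ; onto-surjective = e-surj
             ; into-injective = g-inj ; factorises = g∘e≗f∘suc }
  with any? (λ j → g j ≟ f zero)
... | yes (j , gj≡f0) = record
  { card = k ; onto = e′ ; into = g ; onto-surjective = e′-surj
  ; into-injective = g-inj ; factorises = g∘e′≗f }
  where
  e′ : Fin (suc n) → Fin k
  e′ zero    = j
  e′ (suc x) = e x

  e′-surj : ∀ y → ∃ λ x → e′ x ≡ y
  e′-surj y with x , ex≡y ← e-surj y = suc x , ex≡y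

  g∘e′≗f : ∀ x → g (e′ x) ≡ f x
  g∘e′≗f zero    = gj≡f0
  g∘e′≗f (suc x) = g∘e≗f∘suc x
... | no f0∉img = record
  { card = suc k ; onto = e′ ; into = g′ ; onto-surjective = e′-surj
  ; into-injective = g′-inj ; factorises = g′∘e′≗f }
  where
  e′ : Fin (suc n) → Fin (suc k)
  e′ zero    = zero
  e′ (suc x) = suc (e x)

  g′ : Fin (suc k) → Fin _
  g′ zero    = f zero
  g′ (suc j) = g j

  e′-surj : ∀ y → ∃ λ x → e′ x ≡ y
  e′-surj zero = zero , refl
  e′-surj (suc y) with x , ex≡y ← e-surj y = suc x , cong suc ex≡y

  g′-inj : Injective _≡_ _≡_ g′
  g′-inj {zero}  {zero}  _ = refl
  g′-inj {zero}  {suc y} p = ⊥-elim (f0∉img (y , sym p))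
  g′-inj {suc x} {zero}  p = ⊥-elim (f0∉img (x , p))
  g′-inj {suc x} {suc y} p = cong suc (g-inj p)

  g′∘e′≗f : ∀ x → g′ (e′ x) ≡ f x
  g′∘e′≗f zero    = refl
  g′∘e′≗f (suc x) = g∘e≗f∘suc x

injective-avoiding⇒< : ∀ {k m} {g : Fin k → Fin m} → Injective _≡_ _≡_ g →
                       (b : Fin m) → (∀ j → g j ≢ b) → k < m
injective-avoiding⇒< {m = suc _} {g = g} g-inj b b∉img =
  s≤s (injective⇒≤ λ p → g-inj (punchOut-injective (b≢g _) (b≢g _) p))
  where
  b≢g : ∀ j → b ≢ g j
  b≢g j = b∉img j ∘ sym

-- The image of G under φ (an arc x → y whenever some arc of G is sent to it)
-- is an oriented graph exactly when φ creates neither loops nor digons.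
record ImageIsOriented (G : OGraph) {A : Set} (φ : V G → A) : Set where
  field
    no-loop  : ∀ {u v} → Arc G u v → φ u ≢ φ v
    no-digon : ∀ {u v u′ v′} → Arc G u v → Arc G u′ v′ → φ u ≡ φ v′ → φ v ≢ φ u′

imageIsOriented-∘hom : ∀ {K G A} {φ : V G → A} ((r , r-hom) : Hom K G) →
                       ImageIsOriented G φ → ImageIsOriented K (φ ∘ r)
imageIsOriented-∘hom (r , r-hom) oriented = record
  { no-loop  = λ t → no-loop (r-hom _ _ t)
  ; no-digon = λ t t′ → no-digon (r-hom _ _ t) (r-hom _ _ t′) }
  where open ImageIsOriented oriented

module OrientedImage (G : OGraph) {m : ℕ} (φ : V G → Fin m)
                     (oriented : ImageIsOriented G φ) where
  open ImageIsOriented oriented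
  open ImageFactorisation (imageFactorisation φ) public

  onto-reflects : ∀ u v → onto u ≡ onto v → φ u ≡ φ v
  onto-reflects u v p = trans (sym (factorises u)) (trans (cong into p) (factorises v))

  ImageArc : Fin card → Fin card → Set
  ImageArc x y = ∃ λ u → ∃ λ v → Arc G u v × onto u ≡ x × onto v ≡ y

  imageArc? : ∀ x y → Dec (ImageArc x y)
  imageArc? x y = any? λ u → any? λ v → Arc? G u v ×-dec (onto u ≟ x ×-dec onto v ≟ y)

  image-loopless : ∀ x → does (imageArc? x x) ≡ false
  image-loopless x with imageArc? x x
  ... | yes (u , v , t , ux , vx) = ⊥-elim (no-loop t (onto-reflects u v (trans ux (sym vx))))
  ... | no _ = refl

  image-asym : ∀ x y → does (imageArc? x y) ≡ true → does (imageArc? y x) ≡ false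
  image-asym x y _ with imageArc? x y | imageArc? y x
  image-asym x y _  | yes (u , v , t , ux , vy) | yes (u′ , v′ , t′ , u′y , v′x) =
    ⊥-elim (no-digon t t′ (onto-reflects u v′ (trans ux (sym v′x)))
                          (onto-reflects v u′ (trans vy (sym u′y))))
  image-asym x y _  | _     | no _ = refl
  image-asym x y () | no _  | yes _

  image : OGraph
  image = record
    { size = card ; arc = λ x y → does (imageArc? x y)
    ; loopless = image-loopless ; asym = image-asym }

  onto-hom : IsHom G image onto
  onto-hom u v t with imageArc? (onto u) (onto v)
  ... | yes _ = refl
  ... | no ¬arc = ⊥-elim (¬arc (u , v , t , refl , refl))

  onto-complete : IsComplete G image onto
  onto-complete = onto-hom , onto-surjective , image-arc-lifts
    where
    image-arc-lifts : ∀ x y → Arc image x y → ImageArc x y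
    image-arc-lifts x y t with imageArc? x y
    ... | yes lift = lift
    image-arc-lifts x y () | no _

  image-size< : (b : Fin m) → (∀ u → φ u ≢ b) → card < m
  image-size< b b∉img = injective-avoiding⇒< into-injective b into-avoids
    where
    into-avoids : ∀ j → into j ≢ b
    into-avoids j with u , refl ← onto-surjective j = b∉img u ∘ trans (sym (factorises u))

core-oriented-image-hits-all : ∀ G H → HomFull G → IsCore G H →
                               (φ : V G → V H) → ImageIsOriented G φ →
                               (b : V H) → ¬ (∀ u → φ u ≢ b)
core-oriented-image-hits-all G H full (_ , _ , minimal) φ oriented b b∉img =
  ≤⇒≯ (minimal image (full image (onto , onto-complete)) (onto , onto-hom))
      (image-size< b b∉img)
  where open OrientedImage G φ oriented

module Merge (H : OGraph) (a b : V H) (a≢b : a ≢ b)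
             (a↛b : ¬ Arc H a b) (b↛a : ¬ Arc H b a)
             (no-path : ¬ ∃ λ w → (Arc H a w × Arc H w b) ⊎ (Arc H b w × Arc H w a)) where

  Merged : V H → V H → Set
  Merged x y = (x ≡ a × y ≡ b) ⊎ (x ≡ b × y ≡ a)

  merge : V H → V H
  merge x with x ≟ b
  ... | yes _ = a
  ... | no _  = x

  merge-avoids : ∀ x → merge x ≢ b
  merge-avoids x with x ≟ b
  ... | yes _   = a≢b
  ... | no x≢b = x≢b

  merge-fibres : ∀ x y → merge x ≡ merge y → x ≡ y ⊎ Merged x y
  merge-fibres x y p with x ≟ b | y ≟ b
  ... | yes x≡b | yes y≡b = inj₁ (trans x≡b (sym y≡b))
  ... | yes x≡b | no _    = inj₂ (inj₂ (x≡b , sym p))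
  ... | no _    | yes y≡b = inj₂ (inj₁ (p , y≡b))
  ... | no _    | no _    = inj₁ p

  no-self-arc : ∀ x → ¬ Arc H x x
  no-self-arc x t with () ← trans (sym t) (loopless H x)

  merged-nonadjacent : ∀ {x y} → Merged x y → ¬ Arc H x y
  merged-nonadjacent (inj₁ (refl , refl)) = a↛b
  merged-nonadjacent (inj₂ (refl , refl)) = b↛a

  merged-no-path : ∀ {x w y} → Merged x y → Arc H x w → Arc H w y → ⊥
  merged-no-path (inj₁ (refl , refl)) t t′ = no-path (_ , inj₁ (t , t′))
  merged-no-path (inj₂ (refl , refl)) t t′ = no-path (_ , inj₂ (t , t′))

  merged-sym : ∀ {x y} → Merged x y → Merged y x
  merged-sym (inj₁ (x≡a , y≡b)) = inj₂ (y≡b , x≡a)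
  merged-sym (inj₂ (x≡b , y≡a)) = inj₁ (y≡a , x≡b)

  merge-no-loop : ∀ {u v} → Arc H u v → merge u ≢ merge v
  merge-no-loop {u} {v} t p with merge-fibres u v p
  ... | inj₁ refl = no-self-arc u t
  ... | inj₂ m    = merged-nonadjacent m t

  merge-no-digon : ∀ {u v u′ v′} → Arc H u v → Arc H u′ v′ →
                   merge u ≡ merge v′ → merge v ≢ merge u′
  merge-no-digon {u} {v} {u′} {v′} t t′ p q with merge-fibres u v′ p | merge-fibres v u′ q
  ... | inj₁ refl | inj₁ refl with () ← trans (sym t′) (asym H u v t)
  ... | inj₁ refl | inj₂ m    = merged-no-path (merged-sym m) t′ t
  ... | inj₂ m    | inj₁ refl = merged-no-path m t t′
  ... | inj₂ (inj₁ (refl , refl)) | inj₂ (inj₁ (refl , refl)) = no-self-arc a t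
  ... | inj₂ (inj₁ (refl , refl)) | inj₂ (inj₂ (refl , refl)) = a↛b t
  ... | inj₂ (inj₂ (refl , refl)) | inj₂ (inj₁ (refl , refl)) = b↛a t
  ... | inj₂ (inj₂ (refl , refl)) | inj₂ (inj₂ (refl , refl)) = no-self-arc b t

  merge-oriented : ImageIsOriented H merge
  merge-oriented = record { no-loop = merge-no-loop ; no-digon = merge-no-digon }

theorem6 : (G : OGraph) → HomFull G → (H : OGraph) → IsCore G H → OrientedClique H
theorem6 G full H core@(_ , retraction@(r , _) , _) a b a≢b a↛b b↛a
  with any? (λ w → (Arc? H a w ×-dec Arc? H w b) ⊎-dec (Arc? H b w ×-dec Arc? H w a))
... | yes path = path
... | no no-path =
  ⊥-elim (core-oriented-image-hits-all G H full core (merge ∘ r)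
            (imageIsOriented-∘hom retraction merge-oriented) b (merge-avoids ∘ r))
  where open Merge H a b a≢b a↛b b↛a no-path
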